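{- Let $(M,\mathcal{X})$, with $\mathcal{X}=(X_a)_{a\in V(M)}$, be a median decomposition of a graph $G$. Then for every complete subgraph $K$ of $G$ there is $a\in V(M)$ with $V(K)\subseteq X_a$. In particular, $\omega(G)\leq \mathrm{mw}(G)$.
   Context: All graphs are finite, simple and undirected; $\omega(G)$ is the clique number of $G$ (order of a largest complete subgraph). For vertices $u,v$ of a connected graph, $I(u,v)$ is the set of vertices lying on some shortest $(u,v)$-path. A vertex set $S$ is convex if $I(u,v)\subseteq S$ for all $u,v\in S$. A median graph is a connected graph $M$ such that $|I(u,v)\cap I(v,w)\cap I(w,u)|=1$ for all vertices $u,v,w$. A median decomposition of $G$ is a pair $(M,\mathcal{X})$ with $M$ a median graph and $\mathcal{X}=(X_a)_{a\in V(M)}$ subsets of $V(G)$ such that (M1) every edge $uv$ of $G$ has both ends in some $X_a$, and (M2) for every $v\in V(G)$, $X^{ -1}(v)=\{a\in V(M): v\in X_a\}$ is non-empty and convex in $M$. Its width is $\max_a |X_a|$; the medianwidth $\mathrm{mw}(G)$ is the minimum width of a median decomposition of $G$. -}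

module Defs where

open import Data.Nat using (ℕ; zero; suc; _+_; _<_; _≤_)
open import Data.Fin using (Fin)
open import Data.Fin.Subset using (Subset; _∈_; _⊆_; ∣_∣)
open import Data.Product using (Σ; ∃; ∃-syntax; _×_; _,_)
open import Relation.Binary.PropositionalEquality using (_≡_)
open import Relation.Nullary using (¬_)

record Graph : Set₁ where
  field
    n       : ℕ
    Adj     : Fin n → Fin n → Set
    sym     : ∀ {u v} → Adj u v → Adj v u
    irrefl  : ∀ {u} → ¬ Adj u u
open Graph public

module _ (G : Graph) where

  data Walk : Fin (n G) → Fin (n G) → ℕ → Set where
    here : ∀ {u} → Walk u u zero
    step : ∀ {u v w k} → Adj G u v → Walk v w k → Walk u w (suc k)

  Connected : Set
  Connected = Fin (n G) × (∀ u v → ∃[ k ] Walk u v k)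

  IsDist : Fin (n G) → Fin (n G) → ℕ → Set
  IsDist u v d = Walk u v d × (∀ k → k < d → ¬ Walk u v k)

  InInterval : Fin (n G) → Fin (n G) → Fin (n G) → Set
  InInterval u v w = ∃[ k₁ ] ∃[ k₂ ] (Walk u w k₁ × Walk w v k₂ × IsDist u v (k₁ + k₂))

  Convex : (Fin (n G) → Set) → Set
  Convex S = ∀ u v → S u → S v → ∀ w → InInterval u v w → S w

  IsMedian : Set
  IsMedian = Connected ×
    (∀ u v w → ∃[ x ] ((InInterval u v x × InInterval v w x × InInterval w u x)
                  × (∀ y → InInterval u v y → InInterval v w y → InInterval w u y → y ≡ x)))

  IsClique : Subset (n G) → Set
  IsClique K = ∀ u v → u ∈ K → v ∈ K → ¬ (u ≡ v) → Adj G u v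

  IsCliqueNumber : ℕ → Set
  IsCliqueNumber k = (∃[ K ] (IsClique K × ∣ K ∣ ≡ k)) × (∀ K → IsClique K → ∣ K ∣ ≤ k)

record MedianDecomposition (G : Graph) : Set₁ where
  field
    M        : Graph
    median   : IsMedian M
    X        : Fin (n M) → Subset (n G)
    M1       : ∀ u v → Adj G u v → ∃[ a ] (u ∈ X a × v ∈ X a)
    M2-nonempty : ∀ v → ∃[ a ] (v ∈ X a)
    M2-convex   : ∀ v → Convex M (λ a → v ∈ X a)
open MedianDecomposition public

IsWidth : {G : Graph} → MedianDecomposition G → ℕ → Set
IsWidth D w = (∀ a → ∣ X D a ∣ ≤ w) × ∃[ a ] (∣ X D a ∣ ≡ w)

IsMedianwidth : Graph → ℕ → Set₁
IsMedianwidth G k = (Σ (MedianDecomposition G) λ D → IsWidth D k)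
  × (∀ (D : MedianDecomposition G) w → IsWidth D w → k ≤ w)

-- The bags containing a fixed vertex of G form a convex set of M, and for two adjacent
-- vertices these sets meet by (M1). Convex sets of a median graph have the Helly property:
-- if A, B, C meet pairwise in points c, b, a, the median of a, b, c lies in all three,
-- since it lies on a shortest path between two points of each set. By induction on the
-- number of sets, pairwise meeting finitely many convex sets have a common point, which
-- for the bags of a clique is a bag containing the whole clique.
module Submission where

open import Defs
open import Data.Nat using (ℕ; _≤_; zero; suc)
open import Data.Nat.Properties using (≤-trans)
open import Data.Fin using (Fin; zero; suc)
open import Data.Fin.Properties using (_≟_)
open import Data.Fin.Subset using (Subset; _⊆_; _∈_)
open import Data.Fin.Subset.Properties using (_∈?_; p⊆q⇒∣p∣≤∣q∣)
open import Data.Vec.Functional using (_∷_)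
open import Data.Product using (∃-syntax; _×_; _,_; proj₁; proj₂)
open import Data.Empty using (⊥-elim)
open import Relation.Nullary using (yes; no)
open import Relation.Unary using (Pred; Satisfiable; _∩_; _≬_; ⋂)
open import Relation.Binary.PropositionalEquality using (refl)
open import Level using (0ℓ)

PairwiseMeeting : {A I : Set} → (I → Pred A 0ℓ) → Set
PairwiseMeeting F = ∀ i j → F i ≬ F j

module _ (M : Graph) where

  ∩-convex : {A B : Pred (Fin (n M)) 0ℓ} → Convex M A → Convex M B → Convex M (A ∩ B)
  ∩-convex cA cB u v (uA , uB) (vA , vB) w w∈I = cA u v uA vA w w∈I , cB u v uB vB w w∈I

module Helly (M : Graph) (median : IsMedian M) where

  V : Set
  V = Fin (n M)

  helly₃ : {A B C : Pred V 0ℓ} → Convex M A → Convex M B → Convex M C →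
           B ≬ C → A ≬ C → A ≬ B → Satisfiable (A ∩ (B ∩ C))
  helly₃ cA cB cC (a , aB , aC) (b , bA , bC) (c , cA' , cB')
    with proj₂ median a b c
  ... | m , (m∈Iab , m∈Ibc , m∈Ica) , _ =
    m , cA b c bA cA' m m∈Ibc , cB c a cB' aB m m∈Ica , cC a b aC bC m m∈Iab

  merge₀₁ : {k : ℕ} → (Fin (suc (suc k)) → Pred V 0ℓ) → Fin (suc k) → Pred V 0ℓ
  merge₀₁ F = (F zero ∩ F (suc zero)) ∷ λ i → F (suc (suc i))

  merge₀₁-convex : {k : ℕ} {F : Fin (suc (suc k)) → Pred V 0ℓ} →
                   (∀ i → Convex M (F i)) → ∀ i → Convex M (merge₀₁ F i)
  merge₀₁-convex cF zero    = ∩-convex M (cF zero) (cF (suc zero))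
  merge₀₁-convex cF (suc i) = cF (suc (suc i))

  merge₀₁-pairwiseMeeting : {k : ℕ} {F : Fin (suc (suc k)) → Pred V 0ℓ} →
    (∀ i → Convex M (F i)) → PairwiseMeeting F → PairwiseMeeting (merge₀₁ F)
  merge₀₁-pairwiseMeeting {F = F} cF meet = meet′
    where
    merged≬ : ∀ j → (F zero ∩ F (suc zero)) ≬ F (suc (suc j))
    merged≬ j with helly₃ (cF zero) (cF (suc zero)) (cF (suc (suc j)))
                          (meet (suc zero) (suc (suc j))) (meet zero (suc (suc j)))
                          (meet zero (suc zero))
    ... | x , x∈F₀ , x∈F₁ , x∈Fⱼ = x , (x∈F₀ , x∈F₁) , x∈Fⱼ

    meet′ : PairwiseMeeting (merge₀₁ F)
    meet′ zero zero with meet zero (suc zero)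
    ... | x , x∈F₀ , x∈F₁ = x , (x∈F₀ , x∈F₁) , (x∈F₀ , x∈F₁)
    meet′ zero (suc j) = merged≬ j
    meet′ (suc i) zero with merged≬ i
    ... | x , x∈F₀₁ , x∈Fᵢ = x , x∈Fᵢ , x∈F₀₁
    meet′ (suc i) (suc j) = meet (suc (suc i)) (suc (suc j))

  helly : (k : ℕ) (F : Fin k → Pred V 0ℓ) → (∀ i → Convex M (F i)) →
          PairwiseMeeting F → Satisfiable (⋂ (Fin k) F)
  helly zero          F cF meet = proj₁ (proj₁ median) , λ ()
  helly (suc zero)    F cF meet with meet zero zero
  ... | x , x∈F₀ , _ = x , λ { zero → x∈F₀ }
  helly (suc (suc k)) F cF meet
    with helly (suc k) (merge₀₁ F) (merge₀₁-convex cF) (merge₀₁-pairwiseMeeting cF meet)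
  ... | x , x∈⋂ = x , λ { zero          → proj₁ (x∈⋂ zero)
                        ; (suc zero)    → proj₂ (x∈⋂ zero)
                        ; (suc (suc i)) → x∈⋂ (suc i) }

module _ {G : Graph} (D : MedianDecomposition G) (K : Subset (n G)) where

  -- The bags of v, made to be all of M when v ∉ K, so that a family indexed by
  -- all vertices of G can be fed to helly.
  cliqueBags : Fin (n G) → Pred (Fin (n (M D))) 0ℓ
  cliqueBags v a = v ∈ K → v ∈ X D a

  cliqueBags-convex : ∀ v → Convex (M D) (cliqueBags v)
  cliqueBags-convex v u w u∈B w∈B x x∈I v∈K =
    M2-convex D v u w (u∈B v∈K) (w∈B v∈K) x x∈I

  cliqueBags-pairwiseMeeting : IsClique G K → PairwiseMeeting cliqueBags
  cliqueBags-pairwiseMeeting clique v w with v ∈? K | w ∈? K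
  ... | no v∉K | _ with M2-nonempty D w
  ... | a , w∈Xa = a , (λ v∈K → ⊥-elim (v∉K v∈K)) , λ _ → w∈Xa
  cliqueBags-pairwiseMeeting clique v w | yes _ | no w∉K with M2-nonempty D v
  ... | a , v∈Xa = a , (λ _ → v∈Xa) , λ w∈K → ⊥-elim (w∉K w∈K)
  cliqueBags-pairwiseMeeting clique v w | yes v∈K | yes w∈K with v ≟ w
  ... | yes refl with M2-nonempty D v
  ... | a , v∈Xa = a , (λ _ → v∈Xa) , λ _ → v∈Xa
  cliqueBags-pairwiseMeeting clique v w | yes v∈K | yes w∈K | no v≢w
    with M1 D v w (clique v w v∈K w∈K v≢w)
  ... | a , v∈Xa , w∈Xa = a , (λ _ → v∈Xa) , λ _ → w∈Xa

  clique⊆bag : IsClique G K → ∃[ a ] (K ⊆ X D a)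
  clique⊆bag clique
    with Helly.helly (M D) (median D) (n G) cliqueBags cliqueBags-convex
                     (cliqueBags-pairwiseMeeting clique)
  ... | a , a∈⋂ = a , λ {v} v∈K → a∈⋂ v v∈K

cliqueNumber≤medianwidth : (G : Graph) (ω mw : ℕ) →
  IsCliqueNumber G ω → IsMedianwidth G mw → ω ≤ mw
cliqueNumber≤medianwidth G ω mw ((K , clique , refl) , _) ((D , bagSize≤mw , _) , _)
  with clique⊆bag D K clique
... | a , K⊆Xa = ≤-trans (p⊆q⇒∣p∣≤∣q∣ K⊆Xa) (bagSize≤mw a)

lemma3p3 : (G : Graph) →
    ((D : MedianDecomposition G) → (K : Subset (n G)) → IsClique G K → ∃[ a ] (K ⊆ X D a))
    × ((ω mw : ℕ) → IsCliqueNumber G ω → IsMedianwidth G mw → ω ≤ mw)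
lemma3p3 G = clique⊆bag , cliqueNumber≤medianwidth G
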